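{- Let $D$ be a Ferrers diagram with a prescribed set of $\diamond$-columns, and let $F$ be a partial transversal of $D$ satisfying conditions (C1) and (C2). Then the following are equivalent: (a) $F$ satisfies (C3); (b) all the 1-cells of $F$ in leftist rows lie in the left part of $F$; (c) all the 1-cells of $F$ in rightist rows lie in the right part of $F$.
   Context: A Ferrers diagram is a bottom-justified array of cells in columns of non-increasing heights (height zero allowed); rows are numbered from bottom (1) to top, columns left to right, cell $(i,j)$ in row $i$ and column $j$. A partial filling assigns to a set of columns (the $\diamond$-columns) the symbol $\diamond$ in all their cells, and $0$ or $1$ to the cells of the other (standard) columns; it is a partial transversal if every row and every standard column contains exactly one 1-cell. If $j_0$ is the leftmost $\diamond$-column, the columns $1,\dots,j_0-1$ form the left part and the columns to the right of $j_0$ form the right part; the rows intersecting column $j_0$ form the bottom part and the other rows the top part. If there is no $\diamond$-column, the left part and top part are the whole diagram and the right and bottom parts are empty. Rightist rows: no top-part row is rightist; if the bottom part has $k$ rows, row $i\le k$ is rightist iff the number of its cells lying in the right part exceeds the number of rightist rows above row $i$ (so row $k$ is rightist iff it has a cell in the right part). A row is leftist if it is not rightist. (C1): $F$ has at most two $\diamond$-columns. (C2): if $F$ has at least three columns, at most one $\diamond$-column has nonzero height. (C3): whenever $i<i'$ are rows and $j<j'$ are columns such that cell $(i',j')$ belongs to the diagram, cells $(i',j)$ and $(i,j')$ are 1-cells and cells $(i,j)$ and $(i',j')$ are 0-cells, the columns $j,j'$ either both belong to the left part or both belong to the right part. -}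

module Defs where

open import Data.Nat using (ℕ; zero; suc; _+_; _∸_; _<ᵇ_) renaming (_≤_ to _≤ℕ_; _<_ to _<ℕ_)
open import Data.Fin using (Fin; zero; suc; _<_; _≤_; toℕ)
open import Data.Unit using (⊤)
open import Data.Bool using (Bool; true; false; if_then_else_; _∧_; not)
open import Data.Maybe using (Maybe; just; nothing)
open import Data.Product using (Σ; ∃; _×_; _,_)
open import Data.Sum using (_⊎_)
open import Data.Empty using (⊥)
open import Relation.Binary.PropositionalEquality using (_≡_)

-- Conventions: columns are indexed by Fin n (0 = leftmost);
-- rows are indexed by ℕ from 0 (0 = bottom row, paper's row i+1).
-- Cell (i , j) belongs to the diagram iff i < h j.

count : {n : ℕ} → (Fin n → Bool) → ℕ
count {zero}  p = 0
count {suc n} p = (if p zero then 1 else 0) + count (λ j → p (suc j))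

leftmost : {n : ℕ} → (Fin n → Bool) → Maybe (Fin n)
leftmost {zero}  p = nothing
leftmost {suc n} p with p zero
... | true  = just zero
... | false with leftmost (λ j → p (suc j))
...   | just j  = just (suc j)
...   | nothing = nothing

-- A Ferrers diagram with n columns of non-increasing heights h, a prescribed
-- set of ◇-columns (dia j ≡ true), and a 0/1 assignment val to cells of the
-- standard columns (val j i is meaningful only for standard j and i < h j).
record Filling : Set where
  field
    n     : ℕ
    h     : Fin n → ℕ
    h-mono : ∀ j j' → j ≤ j' → h j' ≤ℕ h j
    dia   : Fin n → Bool
    val   : Fin n → ℕ → Bool

module _ (F : Filling) where
  open Filling F

  InDiagram : ℕ → Fin n → Set
  InDiagram i j = i <ℕ h j

  Standard : Fin n → Set
  Standard j = dia j ≡ false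

  OneCell : ℕ → Fin n → Set
  OneCell i j = InDiagram i j × Standard j × val j i ≡ true

  ZeroCell : ℕ → Fin n → Set
  ZeroCell i j = InDiagram i j × Standard j × val j i ≡ false

  IsRow : ℕ → Set
  IsRow i = ∃ λ j → InDiagram i j

  PartialTransversal : Set
  PartialTransversal =
    (∀ i → IsRow i → ∃ λ j → OneCell i j × (∀ j' → OneCell i j' → j' ≡ j)) ×
    (∀ j → Standard j → ∃ λ i → OneCell i j × (∀ i' → OneCell i' j → i' ≡ i))

  j₀ : Maybe (Fin n)
  j₀ = leftmost dia

  LeftPart : Fin n → Set
  LeftPart j with j₀
  ... | just k  = j < k
  ... | nothing = ⊤

  RightPart : Fin n → Set
  RightPart j with j₀
  ... | just k  = k < j
  ... | nothing = ⊥

  bottomRows : ℕ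
  bottomRows with j₀
  ... | just k  = h k
  ... | nothing = 0

  isRightᵇ : Fin n → Bool
  isRightᵇ j with j₀
  ... | just k  = toℕ k <ᵇ toℕ j
  ... | nothing = false

  rightCells : ℕ → ℕ
  rightCells i = count (λ j → isRightᵇ j ∧ (i <ᵇ h j))

  -- number of rightist rows among the top d rows of the bottom part
  -- (rows k-d, ..., k-1 in 0-based indexing, k = bottomRows)
  rightistAbove : ℕ → ℕ
  rightistAbove zero    = 0
  rightistAbove (suc d) =
    rightistAbove d + (if rightistAbove d <ᵇ rightCells (bottomRows ∸ suc d) then 1 else 0)

  -- row i (0-based) is rightist iff it lies in the bottom part and the number of
  -- its cells in the right part exceeds the number of rightist rows above it
  -- (the rows i+1, ..., k-1, i.e. the top (k ∸ suc i) rows of the bottom part)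
  Rightist : ℕ → Set
  Rightist i = i <ℕ bottomRows × rightistAbove (bottomRows ∸ suc i) <ℕ rightCells i

  Leftist : ℕ → Set
  Leftist i = Rightist i → ⊥

  C1 : Set
  C1 = count dia ≤ℕ 2

  C2 : Set
  C2 = 3 ≤ℕ n → count (λ j → dia j ∧ (0 <ᵇ h j)) ≤ℕ 1

  C3 : Set
  C3 = ∀ i i' (j j' : Fin n) → i <ℕ i' → j < j' → InDiagram i' j' →
       OneCell i' j → OneCell i j' → ZeroCell i j → ZeroCell i' j' →
       (LeftPart j × LeftPart j') ⊎ (RightPart j × RightPart j')

  CondB : Set
  CondB = ∀ i j → Leftist i → OneCell i j → LeftPart j

  CondC : Set
  CondC = ∀ i j → Rightist i → OneCell i j → RightPart j

-- Let k be the leftmost ◇-column; its height is the number K of bottom rows. By (C2) every right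
-- column of positive height is standard, so it holds exactly one 1-cell, necessarily in the bottom
-- part. Compare, for r ≤ K, the number of right 1-cells in rows ≥ r with the number of rightist
-- rows ≥ r. Rightist rows are chosen greedily from the top and never outnumber the right columns
-- reaching the current row, so while the counts agree above row r, a right 1-cell in row r makes it
-- rightist, and the counts can only part at a rightist row without a right 1-cell; (c) and (a) each
-- exclude such a row. Under (b) right 1-cells lie only in rightist rows, so they never outnumber
-- the rightist rows above any r, and since at r = 0 they are at least as many, the counts agree.
-- Conversely, agreement says that a bottom row holds a right 1-cell exactly when it is rightist,
-- which gives (b) and (c) at once, and it leaves no room for a left 1-cell above-left of a right
-- one, the only configuration violating (C3).

module Submission where

open import Defs
open import Data.Bool using (Bool; true; false; T; not; _∧_; if_then_else_)
open import Data.Bool.Properties using (T-∧; T-not-≡; T-≡)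
open import Data.Empty using (⊥; ⊥-elim)
open import Data.Fin using (Fin; zero; suc; toℕ) renaming (_<_ to _<ᶠ_)
import Data.Fin.Properties as Fin
open import Data.Maybe using (just; nothing)
open import Data.Nat using (ℕ; zero; suc; _+_; _∸_; _≤_; _<_; _<ᵇ_; _≤ᵇ_; _<?_; _≤?_; z≤n; s≤s; s≤s⁻¹; z<s)
open import Data.Nat.Properties
open import Data.Product using (∃; _×_; _,_; proj₁; proj₂)
open import Data.Sum using (_⊎_; inj₁; inj₂)
open import Function.Base using (_∘_; id; const)
open import Function.Bundles using (_⇔_; mk⇔; Equivalence)
open import Relation.Nullary using (¬_; yes; no)
open import Relation.Binary.PropositionalEquality
open import Relation.Binary.Definitions using (tri<; tri≈; tri>)

open Equivalence using (to; from)

T-not⇒¬T : ∀ {b} → T (not b) → ¬ T b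
T-not⇒¬T {false} _ ()

¬T⇒T-not : ∀ {b} → ¬ T b → T (not b)
¬T⇒T-not {false} _  = _
¬T⇒T-not {true}  ¬t = ¬t _

count-mono : ∀ {n} {p q : Fin n → Bool} → (∀ j → T (p j) → T (q j)) → count p ≤ count q
count-mono {zero} _ = z≤n
count-mono {suc n} {p} {q} p⊆q with p zero | q zero | p⊆q zero
... | true  | true  | _   = s≤s (count-mono (p⊆q ∘ suc))
... | true  | false | p⊆q₀ = ⊥-elim (p⊆q₀ _)
... | false | true  | _   = m≤n⇒m≤1+n (count-mono (p⊆q ∘ suc))
... | false | false | _   = count-mono (p⊆q ∘ suc)

count-mono-< : ∀ {n} {p q : Fin n → Bool} → (∀ j → T (p j) → T (q j)) →
               ∀ j → ¬ T (p j) → T (q j) → count p < count q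
count-mono-< {suc n} {p} {q} p⊆q zero ¬p₀ q₀ with p zero | q zero
... | true  | _     = ⊥-elim (¬p₀ _)
... | false | true  = s≤s (count-mono (p⊆q ∘ suc))
count-mono-< {suc n} {p} {q} p⊆q (suc j) ¬pj qj with p zero | q zero | p⊆q zero
... | true  | true  | _    = s≤s (count-mono-< (p⊆q ∘ suc) j ¬pj qj)
... | true  | false | p⊆q₀ = ⊥-elim (p⊆q₀ _)
... | false | true  | _    = m≤n⇒m≤1+n (count-mono-< (p⊆q ∘ suc) j ¬pj qj)
... | false | false | _    = count-mono-< (p⊆q ∘ suc) j ¬pj qj

count-none : ∀ {n} {p : Fin n → Bool} → (∀ j → ¬ T (p j)) → count p ≡ 0
count-none {zero} _ = refl
count-none {suc n} {p} none with p zero | none zero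
... | true  | ¬p₀ = ⊥-elim (¬p₀ _)
... | false | _   = count-none (none ∘ suc)

count-pos⇒∃ : ∀ {n} {p : Fin n → Bool} → 0 < count p → ∃ λ j → T (p j)
count-pos⇒∃ {suc n} {p} pos with p zero in p₀
... | true  = zero , subst T (sym p₀) _
... | false with count-pos⇒∃ pos
...   | j , pj = suc j , pj

∃⇒count-pos : ∀ {n} {p : Fin n → Bool} j → T (p j) → 0 < count p
∃⇒count-pos {suc n} {p} zero p₀ with p zero
... | true = s≤s z≤n
∃⇒count-pos {suc n} {p} (suc j) pj with p zero
... | true  = s≤s z≤n
... | false = ∃⇒count-pos j pj

count≤1 : ∀ {n} {p : Fin n → Bool} → (∀ j j' → T (p j) → T (p j') → j ≡ j') → count p ≤ 1
count≤1 {zero} _ = z≤n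
count≤1 {suc n} {p} unique with p zero | unique zero
... | true  | unique₀ = s≤s (≤-reflexive (count-none λ j pj → Fin.0≢1+n (unique₀ (suc j) _ pj)))
... | false | _       = count≤1 λ j j' pj pj' → Fin.suc-injective (unique (suc j) (suc j') pj pj')

count≤1⇒unique : ∀ {n} {p : Fin n → Bool} → count p ≤ 1 → ∀ j j' → T (p j) → T (p j') → j ≡ j'
count≤1⇒unique {suc n} {p} c≤1 j j' pj pj' with p zero in p₀
count≤1⇒unique c≤1 zero    zero     _  _   | _     = refl
count≤1⇒unique c≤1 zero    (suc j') _  pj' | true  = ⊥-elim (≤⇒≯ (s≤s⁻¹ c≤1) (∃⇒count-pos j' pj'))
count≤1⇒unique c≤1 (suc j) _        pj _   | true  = ⊥-elim (≤⇒≯ (s≤s⁻¹ c≤1) (∃⇒count-pos j pj))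
count≤1⇒unique c≤1 zero    (suc j') pj _   | false = ⊥-elim (subst T p₀ pj)
count≤1⇒unique c≤1 (suc j) zero     _  pj' | false = ⊥-elim (subst T p₀ pj')
count≤1⇒unique c≤1 (suc j) (suc j') pj pj' | false = cong suc (count≤1⇒unique c≤1 j j' pj pj')

count-split : ∀ {n} {p q : Fin n → Bool} → (∀ j → T (q j) → T (p j)) →
              count p ≡ count q + count (λ j → p j ∧ not (q j))
count-split {zero} _ = refl
count-split {suc n} {p} {q} q⊆p with p zero | q zero | q⊆p zero
... | true  | true  | _    = cong suc (count-split (q⊆p ∘ suc))
... | true  | false | _    = trans (cong suc (count-split (q⊆p ∘ suc))) (sym (+-suc _ _))
... | false | true  | q⊆p₀ = ⊥-elim (q⊆p₀ _)
... | false | false | _    = count-split (q⊆p ∘ suc)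

downward-induction : ∀ {ℓ} (P : ℕ → Set ℓ) {K} → P K → (∀ r → r < K → P (suc r) → P r) →
                     ∀ r → r ≤ K → P r
downward-induction P {K} P-K step r r≤K = go (K ∸ r) r (m+[n∸m]≡n r≤K)
  where
  go : ∀ d r → r + d ≡ K → P r
  go zero    r r+0≡K = subst P (trans (sym r+0≡K) (+-identityʳ r)) P-K
  go (suc d) r r+d≡K = step r (subst (r <_) r+d≡K (m<m+n r z<s))
                            (go d (suc r) (trans (sym (+-suc r d)) r+d≡K))

-- Domination of the steps gives a r ≤ b r from the common end value at K, and
-- b 0 ≤ a 0 then leaves no room for any step of a to fall short of that of b.
dominated-decrements⇒≡ : ∀ {K} (a b x y : ℕ → ℕ) →
           (∀ r → r < K → a r ≡ a (suc r) + x r) →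
           (∀ r → r < K → b r ≡ b (suc r) + y r) →
           (∀ r → r < K → x r ≤ y r) →
           a K ≡ b K → b 0 ≤ a 0 → ∀ r → r ≤ K → a r ≡ b r
dominated-decrements⇒≡ {K} a b x y a-step b-step x≤y aK≡bK b0≤a0 r r≤K =
  ≤-antisym (+-cancelˡ-≤ (a K) _ _ (subst (λ z → z + a r ≤ a K + b r) (sym aK≡bK) (tail r r≤K)))
            (+-cancelˡ-≤ (a 0) _ _ (≤-trans (head r r≤K) (+-monoˡ-≤ (a r) b0≤a0)))
  where
  tail : ∀ r → r ≤ K → b K + a r ≤ a K + b r
  tail = downward-induction (λ r → b K + a r ≤ a K + b r) (≤-reflexive (+-comm (b K) (a K))) λ r r<K ih →
    begin
      b K + a r                 ≡⟨ cong (b K +_) (a-step r r<K) ⟩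
      b K + (a (suc r) + x r)   ≡⟨ +-assoc (b K) _ _ ⟨
      b K + a (suc r) + x r     ≤⟨ +-mono-≤ ih (x≤y r r<K) ⟩
      a K + b (suc r) + y r     ≡⟨ +-assoc (a K) _ _ ⟩
      a K + (b (suc r) + y r)   ≡⟨ cong (a K +_) (b-step r r<K) ⟨
      a K + b r                 ∎
    where open ≤-Reasoning
  head : ∀ r → r ≤ K → a 0 + b r ≤ b 0 + a r
  head zero    _     = ≤-reflexive (+-comm (a 0) (b 0))
  head (suc r) 1+r≤K = +-cancelʳ-≤ (y r) _ _
    (begin
      a 0 + b (suc r) + y r     ≡⟨ +-assoc (a 0) _ _ ⟩
      a 0 + (b (suc r) + y r)   ≡⟨ cong (a 0 +_) (b-step r 1+r≤K) ⟨
      a 0 + b r                 ≤⟨ head r (<⇒≤ 1+r≤K) ⟩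
      b 0 + a r                 ≡⟨ cong (b 0 +_) (a-step r 1+r≤K) ⟩
      b 0 + (a (suc r) + x r)   ≤⟨ +-monoʳ-≤ (b 0) (+-monoʳ-≤ (a (suc r)) (x≤y r 1+r≤K)) ⟩
      b 0 + (a (suc r) + y r)   ≡⟨ +-assoc (b 0) _ _ ⟨
      b 0 + a (suc r) + y r     ∎)
    where open ≤-Reasoning

<⇒bit≡1 : ∀ {m n} → m < n → (if m <ᵇ n then 1 else 0) ≡ 1
<⇒bit≡1 m<n rewrite to T-≡ (<⇒<ᵇ m<n) = refl

≮⇒bit≡0 : ∀ {m n} → ¬ m < n → (if m <ᵇ n then 1 else 0) ≡ 0
≮⇒bit≡0 {m} {n} m≮n with m <ᵇ n in m<ᵇn
... | false = refl
... | true  = ⊥-elim (m≮n (<ᵇ⇒< m n (from T-≡ m<ᵇn)))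

≤1⇒0⊎1 : ∀ {m} → m ≤ 1 → m ≡ 0 ⊎ m ≡ 1
≤1⇒0⊎1 z≤n       = inj₁ refl
≤1⇒0⊎1 (s≤s z≤n) = inj₂ refl

fin≤2-cover : ∀ {n} → n ≤ 2 → {k c : Fin n} → k <ᶠ c → (j : Fin n) → j ≡ k ⊎ j ≡ c
fin≤2-cover _             {zero}  {suc zero}    _ zero          = inj₁ refl
fin≤2-cover _             {zero}  {suc zero}    _ (suc zero)    = inj₂ refl
fin≤2-cover (s≤s (s≤s z≤n)) {zero} {suc zero}   _ (suc (suc ()))
fin≤2-cover (s≤s (s≤s z≤n)) {zero} {suc (suc ())} _ _
fin≤2-cover (s≤s (s≤s z≤n)) {suc _} {suc (suc ())} _ _
fin≤2-cover _             {suc _} {suc zero}    (s≤s ()) _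

leftmost-just : ∀ {n} (p : Fin n → Bool) {k} → leftmost p ≡ just k → p k ≡ true
leftmost-just {suc n} p e with p zero in p₀
leftmost-just {suc n} p refl | true = p₀
... | false with leftmost (p ∘ suc) in rest
leftmost-just {suc n} p refl | false | just j = leftmost-just (p ∘ suc) rest

module _ (F : Filling) where
  open Filling F

  zeroCell : ∀ {i j} → InDiagram F i j → Standard F j → ¬ OneCell F i j → ZeroCell F i j
  zeroCell {i} {j} ij∈F std ¬one with val j i
  ... | false = ij∈F , std , refl
  ... | true  = ⊥-elim (¬one (ij∈F , std , refl))

  module NoDiamond (j₀≡ : j₀ F ≡ nothing) where

    everyLeft : ∀ {j} → LeftPart F j
    everyLeft rewrite j₀≡ = _

    noBottom : bottomRows F ≡ 0
    noBottom rewrite j₀≡ = refl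

    c3 : C3 F
    c3 _ _ _ _ _ _ _ _ _ _ _ = inj₁ (everyLeft , everyLeft)

    condB : CondB F
    condB _ _ _ _ = everyLeft

    condC : CondC F
    condC i _ (i<K , _) _ = ⊥-elim (≤⇒≯ z≤n (subst (i <_) noBottom i<K))

  module BottomPart (pt : PartialTransversal F) (c2 : C2 F) {k : Fin n} (j₀≡k : j₀ F ≡ just k) where

    leftPart⇔ : ∀ {j} → LeftPart F j ⇔ j <ᶠ k
    leftPart⇔ rewrite j₀≡k = mk⇔ id id

    rightPart⇔ : ∀ {j} → RightPart F j ⇔ k <ᶠ j
    rightPart⇔ rewrite j₀≡k = mk⇔ id id

    isRight⇔ : ∀ {j} → T (isRightᵇ F j) ⇔ k <ᶠ j
    isRight⇔ {j} rewrite j₀≡k = mk⇔ (<ᵇ⇒< (toℕ k) (toℕ j)) <⇒<ᵇ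

    K : ℕ
    K = bottomRows F

    K≡hk : K ≡ h k
    K≡hk rewrite j₀≡k = refl

    diamond-k : dia k ≡ true
    diamond-k = leftmost-just dia j₀≡k

    standard-split : ∀ {j} → Standard F j → j <ᶠ k ⊎ k <ᶠ j
    standard-split {j} std with <-cmp (toℕ j) (toℕ k)
    ... | tri< j<k _ _ = inj₁ j<k
    ... | tri> _ _ k<j = inj₂ k<j
    ... | tri≈ _ j≡k _ with () ← trans (sym diamond-k) (subst (Standard F) (Fin.toℕ-injective j≡k) std)

    right-height≤K : ∀ {c} → k <ᶠ c → h c ≤ K
    right-height≤K {c} k<c = subst (h c ≤_) (sym K≡hk) (h-mono k c (<⇒≤ k<c))

    oneCell-row-unique : ∀ {i j j'} → OneCell F i j → OneCell F i j' → j ≡ j'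
    oneCell-row-unique {i} {j} {j'} one one' with proj₁ pt i (j , proj₁ one)
    ... | _ , _ , unique = trans (unique j one) (sym (unique j' one'))

    oneCell-col-unique : ∀ {i i' j} → OneCell F i j → OneCell F i' j → i ≡ i'
    oneCell-col-unique {i} {i'} {j} one one' with proj₂ pt j (proj₁ (proj₂ one))
    ... | _ , _ , unique = trans (unique i one) (sym (unique i' one'))

    bottom-oneCell : ∀ {r} → r < K → ∃ λ j → OneCell F r j
    bottom-oneCell r<K with proj₁ pt _ (k , subst (_ <_) K≡hk r<K)
    ... | j , one , _ = j , one

    -- A second ◇-column of positive height violates (C2) if n ≥ 3; if n ≤ 2 it leaves no standard
    -- column for the 1-cell of the bottom row.
    right-standard : ∀ {c} → k <ᶠ c → 0 < h c → Standard F c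
    right-standard {c} k<c 0<hc with dia c in dia-c
    ... | false = refl
    ... | true with 3 ≤? n
    ...   | yes 3≤n = ⊥-elim (<-irrefl (cong toℕ k≡c) k<c)
      where
      k≡c : k ≡ c
      k≡c = count≤1⇒unique (c2 3≤n) k c
              (from T-∧ (from T-≡ diamond-k , <⇒<ᵇ (<-≤-trans 0<hc (h-mono k c (<⇒≤ k<c)))))
              (from T-∧ (from T-≡ dia-c , <⇒<ᵇ 0<hc))
    ...   | no 3≰n with proj₁ pt 0 (c , 0<hc)
    ...     | j , (_ , std-j , _) , _ with fin≤2-cover (≮⇒≥ 3≰n) k<c j
    ...       | inj₁ refl with () ← trans (sym diamond-k) std-j
    ...       | inj₂ refl with () ← trans (sym dia-c) std-j

    -- the row of the 1-cell of a standard column; a junk 0 for ◇-columns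
    rowOf : Fin n → ℕ
    rowOf j with dia j | proj₂ pt j
    ... | true  | _         = 0
    ... | false | column-j = proj₁ (column-j refl)

    rowOf-oneCell : ∀ {j} → Standard F j → OneCell F (rowOf j) j
    rowOf-oneCell {j} std with dia j | proj₂ pt j
    ... | false | column-j = proj₁ (proj₂ (column-j refl))

    right-oneCell : ∀ {r c} → k <ᶠ c → r < h c → OneCell F (rowOf c) c
    right-oneCell k<c r<hc = rowOf-oneCell (right-standard k<c (≤-<-trans z≤n r<hc))

    rowOf-unique : ∀ {i j} → OneCell F i j → rowOf j ≡ i
    rowOf-unique one = oneCell-col-unique (rowOf-oneCell (proj₁ (proj₂ one))) one

    RightOneIn : ℕ → Set
    RightOneIn r = ∃ λ c → k <ᶠ c × OneCell F r c

    rightOneFrom : ℕ → Fin n → Bool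
    rightOneFrom r c = (isRightᵇ F c ∧ not (dia c)) ∧ (r ≤ᵇ rowOf c)

    rightOneIn : ℕ → Fin n → Bool
    rightOneIn r c = rightOneFrom r c ∧ not (rightOneFrom (suc r) c)

    rightOneFrom⁺ : ∀ {r c} → T (rightOneFrom r c) → k <ᶠ c × Standard F c × r ≤ rowOf c
    rightOneFrom⁺ {r} {c} t with to T-∧ t
    ... | t₁ , r≤ with to T-∧ t₁
    ...   | right , std = to isRight⇔ right , to T-not-≡ std , ≤ᵇ⇒≤ r (rowOf c) r≤

    rightOneFrom⁻ : ∀ {r c} → k <ᶠ c → Standard F c → r ≤ rowOf c → T (rightOneFrom r c)
    rightOneFrom⁻ k<c std r≤ = from T-∧ (from T-∧ (from isRight⇔ k<c , from T-not-≡ std) , ≤⇒≤ᵇ r≤)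

    rightCell : ℕ → Fin n → Bool
    rightCell r c = isRightᵇ F c ∧ (r <ᵇ h c)

    rightCell⁺ : ∀ {r c} → T (rightCell r c) → k <ᶠ c × r < h c
    rightCell⁺ {r} {c} t with to T-∧ t
    ... | right , r< = to isRight⇔ right , <ᵇ⇒< r (h c) r<

    rightCell⁻ : ∀ {r c} → k <ᶠ c → r < h c → T (rightCell r c)
    rightCell⁻ k<c r< = from T-∧ (from isRight⇔ k<c , <⇒<ᵇ r<)

    rightOneFrom⊆rightCell : ∀ {r r' c} → r ≤ r' → T (rightOneFrom r' c) → T (rightCell r c)
    rightOneFrom⊆rightCell r≤r' t with rightOneFrom⁺ t
    ... | k<c , std , r'≤ = rightCell⁻ k<c (≤-<-trans (≤-trans r≤r' r'≤) (proj₁ (rowOf-oneCell std)))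

    rightOnesFrom : ℕ → ℕ
    rightOnesFrom r = count (rightOneFrom r)

    rightOnesIn : ℕ → ℕ
    rightOnesIn r = count (rightOneIn r)

    rightOneFrom-antitone : ∀ {r r' c} → r ≤ r' → T (rightOneFrom r' c) → T (rightOneFrom r c)
    rightOneFrom-antitone r≤r' t =
      let k<c , std , r'≤ = rightOneFrom⁺ t in rightOneFrom⁻ k<c std (≤-trans r≤r' r'≤)

    rightOneIn⁺ : ∀ {r c} → T (rightOneIn r c) → k <ᶠ c × OneCell F r c
    rightOneIn⁺ {r} {c} t with to T-∧ t
    ... | from-r , not-from-1+r =
      let k<c , std , r≤ = rightOneFrom⁺ from-r
          1+r≰ : ¬ suc r ≤ rowOf c
          1+r≰ = T-not⇒¬T not-from-1+r ∘ rightOneFrom⁻ k<c std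
      in k<c , subst (λ i → OneCell F i c) (sym (≤∧≮⇒≡ r≤ 1+r≰)) (rowOf-oneCell std)

    rightOneIn⁻ : ∀ {r c} → k <ᶠ c → OneCell F r c → T (rightOneIn r c)
    rightOneIn⁻ k<c one@(_ , std , _) =
      from T-∧ ( rightOneFrom⁻ k<c std (≤-reflexive (sym (rowOf-unique one)))
               , ¬T⇒T-not λ t → <-irrefl (sym (rowOf-unique one)) (proj₂ (proj₂ (rightOneFrom⁺ t))))

    rightOnesFrom-split : ∀ r → rightOnesFrom r ≡ rightOnesFrom (suc r) + rightOnesIn r
    rightOnesFrom-split r = count-split λ c → rightOneFrom-antitone {r} {suc r} {c} (n≤1+n r)

    rightOnesIn≤1 : ∀ r → rightOnesIn r ≤ 1
    rightOnesIn≤1 r = count≤1 λ c c' t t' →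
      oneCell-row-unique (proj₂ (rightOneIn⁺ t)) (proj₂ (rightOneIn⁺ t'))

    rightOnesIn-pos⇒ : ∀ {r} → 0 < rightOnesIn r → RightOneIn r
    rightOnesIn-pos⇒ pos = let c , t = count-pos⇒∃ pos in c , rightOneIn⁺ t

    ⇒rightOnesIn-pos : ∀ {r} → RightOneIn r → 0 < rightOnesIn r
    ⇒rightOnesIn-pos (c , k<c , one) = ∃⇒count-pos c (rightOneIn⁻ k<c one)

    rightOnesFrom-K : rightOnesFrom K ≡ 0
    rightOnesFrom-K = count-none λ c t →
      let k<c , std , K≤ = rightOneFrom⁺ {K} {c} t
      in <-irrefl refl (<-≤-trans (≤-<-trans K≤ (proj₁ (rowOf-oneCell std))) (right-height≤K k<c))

    rightOnesFrom≤rightCells : ∀ r → rightOnesFrom r ≤ rightCells F r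
    rightOnesFrom≤rightCells r = count-mono λ c → rightOneFrom⊆rightCell {r} {r} {c} ≤-refl

    rightCells-antitone : ∀ {r r'} → r ≤ r' → rightCells F r' ≤ rightCells F r
    rightCells-antitone {r} {r'} r≤r' = count-mono λ c t →
      let k<c , r'<h = rightCell⁺ {r'} {c} t in rightCell⁻ k<c (≤-<-trans r≤r' r'<h)

    rightCells≤rightOnesFrom0 : rightCells F 0 ≤ rightOnesFrom 0
    rightCells≤rightOnesFrom0 = count-mono λ c t →
      let k<c , 0<h = rightCell⁺ {0} {c} t in rightOneFrom⁻ k<c (right-standard k<c 0<h) z≤n

    rightistFrom : ℕ → ℕ
    rightistFrom r = rightistAbove F (K ∸ r)

    rightistBit : ℕ → ℕ
    rightistBit r = if rightistFrom (suc r) <ᵇ rightCells F r then 1 else 0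

    rightistFrom-K : rightistFrom K ≡ 0
    rightistFrom-K rewrite n∸n≡0 K = refl

    rightistFrom-step : ∀ {r} → r < K → rightistFrom r ≡ rightistFrom (suc r) + rightistBit r
    rightistFrom-step {r} r<K = begin
      rightistAbove F (K ∸ r)        ≡⟨ cong (rightistAbove F) K∸r≡1+d ⟩
      rightistAbove F (suc d)        ≡⟨ cong (λ i → rightistAbove F d + bitAt i) K∸[1+d]≡r ⟩
      rightistFrom (suc r) + rightistBit r ∎
      where
      open ≡-Reasoning
      d = K ∸ suc r
      bitAt : ℕ → ℕ
      bitAt i = if rightistAbove F d <ᵇ rightCells F i then 1 else 0
      K∸r≡1+d : K ∸ r ≡ suc d
      K∸r≡1+d = +-∸-assoc 1 r<K
      K∸[1+d]≡r : K ∸ suc d ≡ r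
      K∸[1+d]≡r = trans (cong (K ∸_) (sym K∸r≡1+d)) (m∸[m∸n]≡n (<⇒≤ r<K))

    rightistFrom≤rightCells : ∀ r → r ≤ K → rightistFrom r ≤ rightCells F r
    rightistFrom≤rightCells = downward-induction (λ r → rightistFrom r ≤ rightCells F r)
      (subst (_≤ rightCells F K) (sym rightistFrom-K) z≤n) step
      where
      open ≤-Reasoning
      step : ∀ r → r < K → rightistFrom (suc r) ≤ rightCells F (suc r) → rightistFrom r ≤ rightCells F r
      step r r<K ih with rightistFrom (suc r) <? rightCells F r
      ... | yes lt = begin
        rightistFrom r                       ≡⟨ rightistFrom-step r<K ⟩
        rightistFrom (suc r) + rightistBit r ≡⟨ cong (rightistFrom (suc r) +_) (<⇒bit≡1 lt) ⟩
        rightistFrom (suc r) + 1             ≡⟨ +-comm (rightistFrom (suc r)) 1 ⟩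
        suc (rightistFrom (suc r))           ≤⟨ lt ⟩
        rightCells F r                       ∎
      ... | no ¬lt = begin
        rightistFrom r                       ≡⟨ rightistFrom-step r<K ⟩
        rightistFrom (suc r) + rightistBit r ≡⟨ cong (rightistFrom (suc r) +_) (≮⇒bit≡0 ¬lt) ⟩
        rightistFrom (suc r) + 0             ≡⟨ +-identityʳ (rightistFrom (suc r)) ⟩
        rightistFrom (suc r)                 ≤⟨ ih ⟩
        rightCells F (suc r)                 ≤⟨ rightCells-antitone (n≤1+n r) ⟩
        rightCells F r                       ∎

    Balanced : Set
    Balanced = ∀ r → r ≤ K → rightOnesFrom r ≡ rightistFrom r

    balanced-step : ∀ {r} → r < K → rightOnesFrom (suc r) ≡ rightistFrom (suc r) →
                    rightOnesFrom r ≡ rightistFrom r ⇔ rightOnesIn r ≡ rightistBit r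
    balanced-step {r} r<K ih = mk⇔
      (λ eq → +-cancelˡ-≡ (rightistFrom (suc r)) _ _ (begin
        rightistFrom (suc r) + rightOnesIn r   ≡⟨ cong (_+ rightOnesIn r) ih ⟨
        rightOnesFrom (suc r) + rightOnesIn r  ≡⟨ rightOnesFrom-split r ⟨
        rightOnesFrom r                        ≡⟨ eq ⟩
        rightistFrom r                         ≡⟨ rightistFrom-step r<K ⟩
        rightistFrom (suc r) + rightistBit r   ∎))
      (λ eq → begin
        rightOnesFrom r                        ≡⟨ rightOnesFrom-split r ⟩
        rightOnesFrom (suc r) + rightOnesIn r  ≡⟨ cong₂ _+_ ih eq ⟩
        rightistFrom (suc r) + rightistBit r   ≡⟨ rightistFrom-step r<K ⟨
        rightistFrom r                         ∎)
      where open ≡-Reasoning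

    rightOne⇒rightist : ∀ {r} → r < K → rightOnesFrom (suc r) ≡ rightistFrom (suc r) →
                        rightOnesIn r ≡ 1 → rightistFrom (suc r) < rightCells F r
    rightOne⇒rightist {r} r<K ih one = begin
      suc (rightistFrom (suc r))             ≡⟨ +-comm 1 (rightistFrom (suc r)) ⟩
      rightistFrom (suc r) + 1               ≡⟨ cong₂ _+_ ih one ⟨
      rightOnesFrom (suc r) + rightOnesIn r  ≡⟨ rightOnesFrom-split r ⟨
      rightOnesFrom r                        ≤⟨ rightOnesFrom≤rightCells r ⟩
      rightCells F r                         ∎
      where open ≤-Reasoning

    balanced-by-induction : (∀ r → r < K → rightOnesFrom (suc r) ≡ rightistFrom (suc r) →
                             rightOnesIn r ≡ 0 → ¬ Rightist F r) → Balanced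
    balanced-by-induction no-lonely-rightist =
      downward-induction (λ r → rightOnesFrom r ≡ rightistFrom r)
        (trans rightOnesFrom-K (sym rightistFrom-K)) step
      where
      step : ∀ r → r < K → rightOnesFrom (suc r) ≡ rightistFrom (suc r) → rightOnesFrom r ≡ rightistFrom r
      step r r<K ih with ≤1⇒0⊎1 (rightOnesIn≤1 r)
      ... | inj₁ none = from (balanced-step r<K ih)
                          (trans none (sym (≮⇒bit≡0 λ lt → no-lonely-rightist r r<K ih none (r<K , lt))))
      ... | inj₂ one  = from (balanced-step r<K ih) (trans one (sym (<⇒bit≡1 (rightOne⇒rightist r<K ih one))))

    balanced⇒rightOne⇔rightist : Balanced → ∀ {r} → r < K → RightOneIn r ⇔ Rightist F r
    balanced⇒rightOne⇔rightist bal {r} r<K = mk⇔ to-rightist to-rightOne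
      where
      ones≡bit : rightOnesIn r ≡ rightistBit r
      ones≡bit = to (balanced-step r<K (bal (suc r) r<K)) (bal r (<⇒≤ r<K))
      to-rightist : RightOneIn r → Rightist F r
      to-rightist ro with rightistFrom (suc r) <? rightCells F r
      ... | yes lt = r<K , lt
      ... | no ¬lt = ⊥-elim (<-irrefl (sym (trans ones≡bit (≮⇒bit≡0 ¬lt))) (⇒rightOnesIn-pos ro))
      to-rightOne : Rightist F r → RightOneIn r
      to-rightOne (_ , lt) = rightOnesIn-pos⇒ (≤-reflexive (sym (trans ones≡bit (<⇒bit≡1 lt))))

    condC⇒balanced : CondC F → Balanced
    condC⇒balanced condC = balanced-by-induction λ r r<K _ none rightist →
      let j , one = bottom-oneCell r<K
      in <-irrefl (sym none) (⇒rightOnesIn-pos (j , to rightPart⇔ (condC r j rightist one) , one))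

    -- (C3) only ever fails on a 1-cell in the left part above-left of a 1-cell in the right part.
    NoCrossing : Set
    NoCrossing = ∀ {i i' j j'} → i < i' → j <ᶠ k → k <ᶠ j' → i' < h j' →
                 OneCell F i' j → OneCell F i j' → ⊥

    c3⇒noCrossing : C3 F → NoCrossing
    c3⇒noCrossing c3 {i} {i'} {j} {j'} i<i' j<k k<j' i'<hj' one-i'j one-ij'
      with c3 i i' j j' i<i' j<j' i'<hj' one-i'j one-ij' zero-ij zero-i'j'
      where
      j<j' = <-trans j<k k<j'
      zero-ij : ZeroCell F i j
      zero-ij = zeroCell (<-≤-trans (<-trans i<i' i'<hj') (h-mono j j' (<⇒≤ j<j'))) (proj₁ (proj₂ one-i'j))
                  λ one-ij → <-irrefl (cong toℕ (oneCell-row-unique one-ij one-ij')) j<j'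
      zero-i'j' : ZeroCell F i' j'
      zero-i'j' = zeroCell i'<hj' (proj₁ (proj₂ one-ij'))
                    λ one-i'j' → <-irrefl (cong toℕ (oneCell-row-unique one-i'j one-i'j')) j<j'
    ... | inj₁ (_ , j'-left)  = <-asym k<j' (to leftPart⇔ j'-left)
    ... | inj₂ (j-right , _) = <-asym j<k (to rightPart⇔ j-right)

    noCrossing⇒c3 : NoCrossing → C3 F
    noCrossing⇒c3 noCrossing i i' j j' i<i' j<j' i'<hj' one-i'j one-ij' _ _
      with standard-split (proj₁ (proj₂ one-ij')) | standard-split (proj₁ (proj₂ one-i'j))
    ... | inj₁ j'<k | _       = inj₁ (from leftPart⇔ (<-trans j<j' j'<k) , from leftPart⇔ j'<k)
    ... | inj₂ k<j' | inj₂ k<j = inj₂ (from rightPart⇔ k<j , from rightPart⇔ (<-trans k<j j<j'))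
    ... | inj₂ k<j' | inj₁ j<k = ⊥-elim (noCrossing i<i' j<k k<j' i'<hj' one-i'j one-ij')

    c3⇒oneAbove : C3 F → ∀ {r c} → r < K → ¬ RightOneIn r → k <ᶠ c → r < h c → r < rowOf c
    c3⇒oneAbove c3 {r} {c} r<K ¬ro k<c r<hc with <-cmp r (rowOf c) | bottom-oneCell r<K
    ... | tri< r<row _ _ | _ = r<row
    ... | tri≈ _ r≡row _ | _ =
      ⊥-elim (¬ro (c , k<c , subst (λ i → OneCell F i c) (sym r≡row) (right-oneCell k<c r<hc)))
    ... | tri> _ _ row<r | j , one-rj with standard-split (proj₁ (proj₂ one-rj))
    ...   | inj₂ k<j = ⊥-elim (¬ro (j , k<j , one-rj))
    ...   | inj₁ j<k = ⊥-elim (c3⇒noCrossing c3 row<r j<k k<c r<hc one-rj (right-oneCell k<c r<hc))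

    c3⇒balanced : C3 F → Balanced
    c3⇒balanced c3 = balanced-by-induction λ r r<K ih none (_ , lt) →
      <⇒≱ lt (subst (rightCells F r ≤_) ih (count-mono λ c t →
        let k<c , r<hc = rightCell⁺ {r} {c} t
        in rightOneFrom⁻ k<c (right-standard k<c (≤-<-trans z≤n r<hc))
             (c3⇒oneAbove c3 r<K (λ ro → <-irrefl (sym none) (⇒rightOnesIn-pos ro)) k<c r<hc)))

    condB⇒balanced : CondB F → Balanced
    condB⇒balanced condB =
      dominated-decrements⇒≡ rightOnesFrom rightistFrom rightOnesIn rightistBit
        (λ r _ → rightOnesFrom-split r) (λ _ → rightistFrom-step) ones≤bit
        (trans rightOnesFrom-K (sym rightistFrom-K))
        (≤-trans (rightistFrom≤rightCells 0 z≤n) rightCells≤rightOnesFrom0)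
      where
      ones≤bit : ∀ r → r < K → rightOnesIn r ≤ rightistBit r
      ones≤bit r r<K with ≤1⇒0⊎1 (rightOnesIn≤1 r)
      ... | inj₁ none = subst (_≤ rightistBit r) (sym none) z≤n
      ... | inj₂ one with rightOnesIn-pos⇒ (≤-reflexive (sym one)) | rightistFrom (suc r) <? rightCells F r
      ...   | _               | yes lt = ≤-reflexive (trans one (sym (<⇒bit≡1 lt)))
      ...   | c , k<c , one-c | no ¬lt =
        ⊥-elim (<-asym k<c (to leftPart⇔ (condB r c (λ (_ , lt) → ¬lt lt) one-c)))

    balanced⇒condB : Balanced → CondB F
    balanced⇒condB bal i j leftist one with standard-split (proj₁ (proj₂ one))
    ... | inj₁ j<k = from leftPart⇔ j<k
    ... | inj₂ k<j = ⊥-elim (leftist (to (balanced⇒rightOne⇔rightist bal i<K) (j , k<j , one)))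
      where i<K = <-≤-trans (proj₁ one) (right-height≤K k<j)

    balanced⇒condC : Balanced → CondC F
    balanced⇒condC bal i j rightist@(i<K , _) one
      with from (balanced⇒rightOne⇔rightist bal i<K) rightist
    ... | c , k<c , one-c with oneCell-row-unique one one-c
    ...   | refl = from rightPart⇔ k<c

    -- Row i' is not rightist, so every right column reaching row i' would have its 1-cell above
    -- row i'; that of j' is below.
    balanced⇒noCrossing : Balanced → NoCrossing
    balanced⇒noCrossing bal {i} {i'} {j} {j'} i<i' j<k k<j' i'<hj' one-i'j one-ij' =
      <-irrefl refl (<-≤-trans ones<cells cells≤ones)
      where
      i'<K = <-≤-trans i'<hj' (right-height≤K k<j')
      ¬rightist : ¬ Rightist F i'
      ¬rightist rightist with from (balanced⇒rightOne⇔rightist bal i'<K) rightist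
      ... | c , k<c , one-c = <-asym j<k (subst (k <ᶠ_) (sym (oneCell-row-unique one-i'j one-c)) k<c)
      cells≤ones : rightCells F i' ≤ rightOnesFrom (suc i')
      cells≤ones = subst (rightCells F i' ≤_) (sym (bal (suc i') i'<K)) (≮⇒≥ λ lt → ¬rightist (i'<K , lt))
      ones<cells : rightOnesFrom (suc i') < rightCells F i'
      ones<cells = count-mono-< (λ c → rightOneFrom⊆rightCell {i'} {suc i'} {c} (n≤1+n i')) j'
        (λ t → <-asym i<i' (subst (i' <_) (rowOf-unique one-ij') (proj₂ (proj₂ (rightOneFrom⁺ t)))))
        (rightCell⁻ k<j' i'<hj')

lemma11 : (F : Filling) → PartialTransversal F → C1 F → C2 F →
          (C3 F ⇔ CondB F) × (C3 F ⇔ CondC F)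
lemma11 F pt _ c2 = byLeftmostDiamond (j₀ F) refl
  where
  byLeftmostDiamond : ∀ m → j₀ F ≡ m → (C3 F ⇔ CondB F) × (C3 F ⇔ CondC F)
  byLeftmostDiamond (just k) j₀≡k =
      mk⇔ (balanced⇒condB ∘ c3⇒balanced) (noCrossing⇒c3 ∘ balanced⇒noCrossing ∘ condB⇒balanced)
    , mk⇔ (balanced⇒condC ∘ c3⇒balanced) (noCrossing⇒c3 ∘ balanced⇒noCrossing ∘ condC⇒balanced)
    where open BottomPart F pt c2 j₀≡k
  byLeftmostDiamond nothing j₀≡nothing =
    mk⇔ (const condB) (const c3) , mk⇔ (const condC) (const c3)
    where open NoDiamond F j₀≡nothing
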